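{- Let $\mathcal{R}$ be a finite set of rewrite rules, let $\Delta$ be a basis, and let $T, T'$ be CLS terms. If $\vdash T : \langle \mathtt{P}, \emptyset\rangle$ (derivation from the empty basis) for some set $\mathtt{P}$ of basic types, and $T \Rightarrow_\Delta T'$, then $\vdash T' : \langle \mathtt{P}', \emptyset\rangle$ for some set $\mathtt{P}'$ of basic types.
   Context: CLS syntax. Fix an alphabet $\mathcal{E}$ of element symbols $a,b,\dots$. Sequences: $S ::= \epsilon \mid a \mid S\cdot S$. Terms: $T ::= S \mid (S)^L\rfloor T \mid T\,|\,T$, where $(S)^L\rfloor T$ denotes a looping sequence (membrane) $S$ containing $T$. Structural congruence $\equiv$ is the least congruence such that $\cdot$ is associative with unit $\epsilon$; $|$ is associative and commutative with unit $\epsilon$; $(\epsilon)^L\rfloor\epsilon\equiv\epsilon$; $(S_1\cdot S_2)^L\rfloor T\equiv (S_2\cdot S_1)^L\rfloor T$; and congruent sequences are congruent as terms and may be exchanged inside loops. Patterns additionally allow term variables $X,Y,\dots$, sequence variables $\tilde x,\tilde y,\dots$ and element variables $x,y,\dots$: $P ::= SP \mid (SP)^L\rfloor P \mid P\,|\,P \mid X$, $SP ::= \epsilon\mid a\mid SP\cdot SP\mid \tilde x\mid x$. An instantiation $\sigma$ maps term variables to terms, sequence variables to sequences and element variables to elements of $\mathcal{E}$; $P\sigma$ denotes the result of substitution. A rewrite rule $P_1\mapsto P_2$ is a pair of patterns with $P_1\not\equiv\epsilon$ and every variable of $P_2$ occurring in $P_1$. Contexts: $C ::= \square \mid C\,|\,T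 \mid T\,|\,C \mid (S)^L\rfloor C$; $C[T]$ is $C$ with the hole replaced by $T$. Types. Fix an assignment $\Gamma$ of a basic type to each element of $\mathcal{E}$ (written $a:t\in\Gamma$). For each basic type $t$ there are fixed sets $R_t$ (required) and $E_t$ (excluded) of basic types with $t\notin R_t\cup E_t$ and $R_t\cap E_t=\emptyset$. For a set $\mathtt P$ of basic types let $\overline{E}(\mathtt P)=\bigcup_{t\in\mathtt P}E_t$. A type is a pair $\langle\mathtt P,\mathtt R\rangle$ of sets of basic types (present, required); it is well formed if $\mathtt P\cap\overline E(\mathtt P)=\mathtt P\cap\mathtt R=\mathtt R\cap\overline E(\mathtt P)=\emptyset$. Well-formed types $\langle\mathtt P,\mathtt R\rangle,\langle\mathtt P',\mathtt R'\rangle$ are compatible, written $\langle\mathtt P,\mathtt R\rangle\bowtie\langle\mathtt P',\mathtt R'\rangle$, if $\overline E(\mathtt P)\cap\mathtt P'=\overline E(\mathtt P)\cap\mathtt R'=\overline E(\mathtt P')\cap\mathtt P=\overline E(\mathtt P')\cap\mathtt R=\emptyset$; their conjunction is $\langle\mathtt P\cup\mathtt P',(\mathtt R\cup\mathtt R')\setminus(\mathtt P\cup\mathtt P')\rangle$. A basis $\Delta$ assigns to finitely many element variables types of the form $\langle\{t\},R_t\rangle$ and to finitely many term/sequence variables types $\langle\mathtt P,\mathtt R\rangle$; it is well formed if all its types are. Typing judgements $\Delta\vdash P:\langle\mathtt P,\mathtt R\rangle$ are derived by: $\Delta,\rho:\langle\mathtt P,\mathtt R\rangle\vdash\rho:\langle\mathtt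 P,\mathtt R\rangle$ for any variable $\rho$; $\Delta\vdash\epsilon:\langle\emptyset,\emptyset\rangle$; if $a:t\in\Gamma$ then $\Delta\vdash a:\langle\{t\},R_t\rangle$; if $\Delta\vdash SP:\langle\mathtt P,\mathtt R\rangle$, $\Delta\vdash SP':\langle\mathtt P',\mathtt R'\rangle$ and these types are compatible then $\Delta\vdash SP\cdot SP'$ has their conjunction as type; likewise for $P\,|\,P'$ with patterns $P,P'$; if $\Delta\vdash SP:\langle\mathtt P,\mathtt R\rangle$, $\Delta\vdash P:\langle\mathtt P',\mathtt R'\rangle$, the two types are compatible and $\mathtt R'\subseteq\mathtt P$, then $\Delta\vdash (SP)^L\rfloor P:\langle\mathtt P,\mathtt R\setminus\mathtt P'\rangle$. $\vdash$ without basis means the empty basis. Typed semantics. A well-formed type $\langle\mathtt P,\mathtt R\rangle$ is OK for a context $C$ if $X:\langle\mathtt P,\mathtt R\rangle\vdash C[X]:\langle\mathtt P',\emptyset\rangle$ for some $\mathtt P'$ ($X$ a term variable). A rule $P_1\mapsto P_2$ is a $\Delta$-$\langle\mathtt P,\mathtt R\rangle$-reduction rule if $\Delta\vdash P_2:\langle\mathtt P,\mathtt R\rangle$. An instantiation $\sigma$ agrees with $\Delta$ if $\rho:\langle\mathtt P,\mathtt R\rangle\in\Delta$ implies $\vdash\sigma(\rho):\langle\mathtt P,\mathtt R\rangle$. Given a finite set $\mathcal R$ of rewrite rules, $\Rightarrow_\Delta$ is the least relation on terms closed under $\equiv$ (on both sides) such that $C[P_1\sigma]\Rightarrow_\Delta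 C[P_2\sigma]$ whenever $P_1\mapsto P_2\in\mathcal R$ is a $\Delta$-$\langle\mathtt P,\mathtt R\rangle$-reduction rule, $P_1\sigma\not\equiv\epsilon$, $\sigma$ agrees with $\Delta$, $C$ is a context, and $\langle\mathtt P,\mathtt R\rangle$ is OK for $C$. -}

module Defs where

open import Level using (0ℓ)
open import Data.Bool using (Bool; true; false)
open import Data.Nat using (ℕ; zero; suc)
open import Data.Maybe using (Maybe; just; nothing)
open import Data.List using (List; [])
open import Data.List.Membership.Propositional using (_∈_)
open import Data.Product using (Σ; ∃; _×_; _,_)
open import Data.Empty using (⊥)
open import Relation.Nullary using (¬_)
open import Relation.Unary using (Pred; ∅; ｛_｝; _⊆_; Empty; _∪_; _∩_; _∖_)
open import Relation.Binary.PropositionalEquality using (_≡_; refl)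

record Sig : Set₁ where
  field
    Elem    : Set
    BType   : Set
    Γ       : Elem → BType        -- a : t ∈ Γ  iff  Γ a ≡ t
    Req     : BType → Pred BType 0ℓ
    Excl    : BType → Pred BType 0ℓ
    t∉Req   : ∀ t → ¬ Req t t
    t∉Excl  : ∀ t → ¬ Excl t t
    Req∩Excl : ∀ t → Empty (Req t ∩ Excl t)

module CLS (𝕊 : Sig) where
  open Sig 𝕊

  -- Syntax.  Index true = patterns (variables allowed), false = ground
  -- sequences / terms.

  data Seq : Bool → Set where
    ε    : ∀ {v} → Seq v
    el   : ∀ {v} → Elem → Seq v
    _·_  : ∀ {v} → Seq v → Seq v → Seq v
    svar : ℕ → Seq true
    evar : ℕ → Seq true

  data Term : Bool → Set where
    seq  : ∀ {v} → Seq v → Term v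
    loop : ∀ {v} → Seq v → Term v → Term v     -- (S)^L ⌋ T
    _∣_  : ∀ {v} → Term v → Term v → Term v
    tvar : ℕ → Term true

  Sequence = Seq false
  CTerm    = Term false
  SeqPat   = Seq true
  Pattern  = Term true

  embS : ∀ {v} → Sequence → Seq v
  embS ε = ε
  embS (el a) = el a
  embS (s · s') = embS s · embS s'

  embT : ∀ {v} → CTerm → Term v
  embT (seq s) = seq (embS s)
  embT (loop s t) = loop (embS s) (embT t)
  embT (t ∣ t') = embT t ∣ embT t'

  data _≈S_ {v} : Seq v → Seq v → Set where
    refl≈  : ∀ {s} → s ≈S s
    sym≈   : ∀ {s s'} → s ≈S s' → s' ≈S s
    trans≈ : ∀ {s s' s''} → s ≈S s' → s' ≈S s'' → s ≈S s''
    ·-cong : ∀ {s₁ s₁' s₂ s₂'} → s₁ ≈S s₁' → s₂ ≈S s₂' → (s₁ · s₂) ≈S (s₁' · s₂')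
    ·-assoc : ∀ {s₁ s₂ s₃} → ((s₁ · s₂) · s₃) ≈S (s₁ · (s₂ · s₃))
    ·-unitˡ : ∀ {s} → (ε · s) ≈S s
    ·-unitʳ : ∀ {s} → (s · ε) ≈S s

  data _≈T_ {v} : Term v → Term v → Set where
    refl≈  : ∀ {t} → t ≈T t
    sym≈   : ∀ {t t'} → t ≈T t' → t' ≈T t
    trans≈ : ∀ {t t' t''} → t ≈T t' → t' ≈T t'' → t ≈T t''
    seq-cong  : ∀ {s s'} → s ≈S s' → seq s ≈T seq s'
    loop-cong : ∀ {s s' t t'} → s ≈S s' → t ≈T t' → loop s t ≈T loop s' t'
    ∣-cong : ∀ {t₁ t₁' t₂ t₂'} → t₁ ≈T t₁' → t₂ ≈T t₂' → (t₁ ∣ t₂) ≈T (t₁' ∣ t₂')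
    ∣-assoc : ∀ {t₁ t₂ t₃} → ((t₁ ∣ t₂) ∣ t₃) ≈T (t₁ ∣ (t₂ ∣ t₃))
    ∣-comm  : ∀ {t₁ t₂} → (t₁ ∣ t₂) ≈T (t₂ ∣ t₁)
    ∣-unit  : ∀ {t} → (t ∣ seq ε) ≈T t
    loop-empty : loop ε (seq ε) ≈T seq ε
    loop-rot   : ∀ {s₁ s₂ t} → loop (s₁ · s₂) t ≈T loop (s₂ · s₁) t

  data Var : Set where
    tv sv ev : ℕ → Var

  data _occS_ : Var → SeqPat → Set where
    o-svar : ∀ {n} → sv n occS svar n
    o-evar : ∀ {n} → ev n occS evar n
    o-·ˡ   : ∀ {ρ s s'} → ρ occS s → ρ occS (s · s')
    o-·ʳ   : ∀ {ρ s s'} → ρ occS s' → ρ occS (s · s')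

  data _occT_ : Var → Pattern → Set where
    o-tvar  : ∀ {n} → tv n occT tvar n
    o-seq   : ∀ {ρ s} → ρ occS s → ρ occT seq s
    o-loopˢ : ∀ {ρ s t} → ρ occS s → ρ occT loop s t
    o-loopᵗ : ∀ {ρ s t} → ρ occT t → ρ occT loop s t
    o-∣ˡ    : ∀ {ρ t t'} → ρ occT t → ρ occT (t ∣ t')
    o-∣ʳ    : ∀ {ρ t t'} → ρ occT t' → ρ occT (t ∣ t')

  record Inst : Set where
    field
      σT : ℕ → CTerm
      σS : ℕ → Sequence
      σE : ℕ → Elem
  open Inst public

  instS : SeqPat → Inst → Sequence
  instS ε σ = ε
  instS (el a) σ = el a
  instS (s · s') σ = instS s σ · instS s' σ
  instS (svar n) σ = σS σ n
  instS (evar n) σ = el (σE σ n)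

  instT : Pattern → Inst → CTerm
  instT (seq s) σ = seq (instS s σ)
  instT (loop s t) σ = loop (instS s σ) (instT t σ)
  instT (t ∣ t') σ = instT t σ ∣ instT t' σ
  instT (tvar n) σ = σT σ n

  record Rule : Set where
    field
      lhs rhs : Pattern
      lhs≢ε   : ¬ (lhs ≈T seq ε)
      vars⊆   : ∀ ρ → ρ occT rhs → ρ occT lhs
  open Rule public

  -- Types (sets of basic types are predicates; equality of types is
  -- extensional, see _≐_).

  record Ty : Set₁ where
    constructor ⟨_,_⟩
    field
      Pr : Pred BType 0ℓ
      Rq : Pred BType 0ℓ
  open Ty public

  Ē : Pred BType 0ℓ → Pred BType 0ℓ
  Ē P u = ∃ λ t → P t × Excl t u

  WF : Ty → Set
  WF ⟨ P , R ⟩ = Empty (P ∩ Ē P) × Empty (P ∩ R) × Empty (R ∩ Ē P)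

  _⋈_ : Ty → Ty → Set
  ⟨ P , R ⟩ ⋈ ⟨ P' , R' ⟩ =
    WF ⟨ P , R ⟩ × WF ⟨ P' , R' ⟩ ×
    Empty (Ē P ∩ P') × Empty (Ē P ∩ R') × Empty (Ē P' ∩ P) × Empty (Ē P' ∩ R)

  _⊓_ : Ty → Ty → Ty
  ⟨ P , R ⟩ ⊓ ⟨ P' , R' ⟩ = ⟨ P ∪ P' , (R ∪ R') ∖ (P ∪ P') ⟩

  elTy : BType → Ty
  elTy t = ⟨ ｛ t ｝ , Req t ⟩

  _≐_ : Ty → Ty → Set
  ⟨ P , R ⟩ ≐ ⟨ P' , R' ⟩ = (P ⊆ P') × (P' ⊆ P) × (R ⊆ R') × (R' ⊆ R)

  record Basis : Set₁ where
    field
      ty     : Var → Maybe Ty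
      finite : ∃ λ (vs : List Var) → ∀ ρ τ → ty ρ ≡ just τ → ρ ∈ vs
      elemTy : ∀ n τ → ty (ev n) ≡ just τ → ∃ λ t → τ ≡ elTy t
  open Basis public

  emptyBasis : Basis
  emptyBasis = record
    { ty = λ _ → nothing
    ; finite = [] , (λ _ _ ())
    ; elemTy = λ _ _ () }

  -- the basis  X : τ  (X the term variable number 0)
  singleBasis : Ty → Basis
  singleBasis τ = record { ty = f ; finite = vs ; elemTy = e }
    where
    f : Var → Maybe Ty
    f (tv zero) = just τ
    f _ = nothing
    vs : ∃ λ (l : List Var) → ∀ ρ τ' → f ρ ≡ just τ' → ρ ∈ l
    vs = (tv zero Data.List.∷ []) , g
      where
      open import Data.List.Relation.Unary.Any using (here)
      g : ∀ ρ τ' → f ρ ≡ just τ' → ρ ∈ (tv zero Data.List.∷ [])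
      g (tv zero) _ _ = here refl
      g (tv (suc _)) _ ()
      g (sv _) _ ()
      g (ev _) _ ()
    e : ∀ n τ' → f (ev n) ≡ just τ' → ∃ λ t → τ' ≡ elTy t
    e n τ' ()

  data _⊢S_∶_ (Δ : Basis) : ∀ {v} → Seq v → Ty → Set₁ where
    t-svar : ∀ {n τ} → ty Δ (sv n) ≡ just τ → Δ ⊢S svar n ∶ τ
    t-evar : ∀ {n τ} → ty Δ (ev n) ≡ just τ → Δ ⊢S evar n ∶ τ
    t-ε    : ∀ {v} → Δ ⊢S (ε {v}) ∶ ⟨ ∅ , ∅ ⟩
    t-el   : ∀ {v} a → Δ ⊢S (el {v} a) ∶ elTy (Γ a)
    t-·    : ∀ {v} {s s' : Seq v} {τ τ'} →
             Δ ⊢S s ∶ τ → Δ ⊢S s' ∶ τ' → τ ⋈ τ' → Δ ⊢S (s · s') ∶ (τ ⊓ τ')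

  data _⊢_∶_ (Δ : Basis) : ∀ {v} → Term v → Ty → Set₁ where
    t-tvar : ∀ {n τ} → ty Δ (tv n) ≡ just τ → Δ ⊢ tvar n ∶ τ
    t-seq  : ∀ {v} {s : Seq v} {τ} → Δ ⊢S s ∶ τ → Δ ⊢ seq s ∶ τ
    t-∣    : ∀ {v} {t t' : Term v} {τ τ'} →
             Δ ⊢ t ∶ τ → Δ ⊢ t' ∶ τ' → τ ⋈ τ' → Δ ⊢ (t ∣ t') ∶ (τ ⊓ τ')
    t-loop : ∀ {v} {s : Seq v} {t : Term v} {P R P' R'} →
             Δ ⊢S s ∶ ⟨ P , R ⟩ → Δ ⊢ t ∶ ⟨ P' , R' ⟩ →
             ⟨ P , R ⟩ ⋈ ⟨ P' , R' ⟩ → R' ⊆ P →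
             Δ ⊢ loop s t ∶ ⟨ P , R ∖ P' ⟩

  _⊢S_∶≈_ : Basis → ∀ {v} → Seq v → Ty → Set₁
  Δ ⊢S s ∶≈ τ = ∃ λ τ' → (Δ ⊢S s ∶ τ') × (τ' ≐ τ)

  _⊢_∶≈_ : Basis → ∀ {v} → Term v → Ty → Set₁
  Δ ⊢ t ∶≈ τ = ∃ λ τ' → (Δ ⊢ t ∶ τ') × (τ' ≐ τ)

  data Ctx : Set where
    □    : Ctx
    _∣ₗ_ : Ctx → CTerm → Ctx
    _∣ᵣ_ : CTerm → Ctx → Ctx
    loopC : Sequence → Ctx → Ctx

  plug : ∀ {v} → Ctx → Term v → Term v
  plug □ t = t
  plug (C ∣ₗ u) t = plug C t ∣ embT u
  plug (u ∣ᵣ C) t = embT u ∣ plug C t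
  plug (loopC s C) t = loop (embS s) (plug C t)

  OKfor : Ty → Ctx → Set₁
  OKfor τ C = WF τ × ∃ λ P' → singleBasis τ ⊢ plug C (tvar 0) ∶≈ ⟨ P' , ∅ ⟩

  AgreesWith : Inst → Basis → Set₁
  AgreesWith σ Δ =
      (∀ n τ → ty Δ (tv n) ≡ just τ → emptyBasis ⊢ σT σ n ∶≈ τ)
    × (∀ n τ → ty Δ (sv n) ≡ just τ → emptyBasis ⊢S σS σ n ∶≈ τ)
    × (∀ n τ → ty Δ (ev n) ≡ just τ → emptyBasis ⊢S el {false} (σE σ n) ∶≈ τ)

  data Red (ℛ : List Rule) (Δ : Basis) : CTerm → CTerm → Set₁ where
    step : ∀ {r} → r ∈ ℛ → ∀ (τ : Ty) (σ : Inst) (C : Ctx) →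
           Δ ⊢ rhs r ∶≈ τ →
           ¬ (instT (lhs r) σ ≈T seq ε) →
           AgreesWith σ Δ →
           OKfor τ C →
           Red ℛ Δ (plug C (instT (lhs r) σ)) (plug C (instT (rhs r) σ))
    closed : ∀ {T U U' T'} → T ≈T U → Red ℛ Δ U U' → U' ≈T T' → Red ℛ Δ T T'

-- A reduction step C[P₁σ] ⇒ C[P₂σ] is licensed by a typing Δ ⊢ P₂ : τ of
-- the right-hand side, an instantiation σ agreeing with Δ and a context C
-- for which τ is OK.  So the result is typed by two uses of one
-- substitution lemma: first σ turns Δ ⊢ P₂ : τ into ⊢ P₂σ : τ, then
-- filling the hole X of C[X] with P₂σ turns X:τ ⊢ C[X] : ⟨P',∅⟩ into
-- ⊢ C[P₂σ] : ⟨P',∅⟩.  Closing the relation under ≡ needs subject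
-- congruence: structurally congruent ground terms have the same types.
--
-- Types are pairs of predicates, so all type equalities are extensional
-- (≐).

module Submission where

open import Defs
open import Data.List using (List)
open import Data.Product using (∃; _×_; _,_; proj₁; proj₂)
open import Data.Sum using (inj₁; inj₂)
open import Data.Nat using (zero; suc)
open import Data.Maybe using (just)
open import Level using (0ℓ)
open import Relation.Unary using (Pred; ∅; _⊆_; _∪_; _∩_; _∖_)
import Relation.Unary as Sets
import Relation.Unary.Properties as Sets
open import Relation.Unary.Algebra using (∪-cong; ∪-comm; ∪-assoc)
open import Relation.Binary.PropositionalEquality using (_≡_; refl; cong; cong₂; subst)

module SubjectReduction (𝕊 : Sig) where
  open Sig 𝕊
  open CLS 𝕊

  Types : Set₁
  Types = Pred BType 0ℓ

  _≃_ : Types → Types → Set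
  _≃_ = Sets._≐_

  ∖-cong : ∀ {A A' B B' : Types} → A ≃ A' → B ≃ B' → (A ∖ B) ≃ (A' ∖ B')
  ∖-cong (a , a') (b , b') = (λ (x , x∉B) → a x , λ y → x∉B (b' y)) , (λ (x , x∉B') → a' x , λ y → x∉B' (b y))

  -- Right unit of union for the empty set ∅ of Relation.Unary (Relation.Unary.Algebra
  -- states it for a universe-polymorphic ∅, which is a different predicate).
  ∪-identityʳ : ∀ {A : Types} → (A ∪ ∅) ≃ A
  ∪-identityʳ = (λ { (inj₁ x) → x ; (inj₂ ()) }) , inj₁

  ∖-disjoint : ∀ {A B : Types} → Sets.Empty (B ∩ A) → (A ∖ B) ≃ A
  ∖-disjoint {A} {B} B∩A=∅ = proj₁ , λ {x} a → a , λ b → B∩A=∅ x (b , a)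

  ∖-absorbˡ : ∀ {A B Q S : Types} → Q ⊆ S → (((A ∖ Q) ∪ B) ∖ S) ≃ ((A ∪ B) ∖ S)
  ∖-absorbˡ Q⊆S =
    (λ { (inj₁ (a , _) , ∉S) → inj₁ a , ∉S ; (inj₂ b , ∉S) → inj₂ b , ∉S }) ,
    (λ { (inj₁ a , ∉S) → inj₁ (a , λ q → ∉S (Q⊆S q)) , ∉S ; (inj₂ b , ∉S) → inj₂ b , ∉S })

  ∖-absorbʳ : ∀ {A B Q S : Types} → Q ⊆ S → ((A ∪ (B ∖ Q)) ∖ S) ≃ ((A ∪ B) ∖ S)
  ∖-absorbʳ Q⊆S =
    (λ { (inj₁ a , ∉S) → inj₁ a , ∉S ; (inj₂ (b , _) , ∉S) → inj₂ b , ∉S }) ,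
    (λ { (inj₁ a , ∉S) → inj₁ a , ∉S ; (inj₂ b , ∉S) → inj₂ (b , λ q → ∉S (Q⊆S q)) , ∉S })

  disjoint-⊆ : ∀ {A A' B B' : Types} → A' ⊆ A → B' ⊆ B → Sets.Empty (A ∩ B) → Sets.Empty (A' ∩ B')
  disjoint-⊆ a b A∩B=∅ x (x∈A' , x∈B') = A∩B=∅ x (a x∈A' , b x∈B')

  Ē-mono : ∀ {A B : Types} → A ⊆ B → Ē A ⊆ Ē B
  Ē-mono A⊆B (t , t∈A , excl) = t , A⊆B t∈A , excl

  Ē-∪ : ∀ {A B : Types} → Ē (A ∪ B) ⊆ (Ē A ∪ Ē B)
  Ē-∪ (t , inj₁ t∈A , excl) = inj₁ (t , t∈A , excl)
  Ē-∪ (t , inj₂ t∈B , excl) = inj₂ (t , t∈B , excl)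

  ≐-intro : ∀ {P P' R R' : Types} → P ≃ P' → R ≃ R' → ⟨ P , R ⟩ ≐ ⟨ P' , R' ⟩
  ≐-intro (p , p') (r , r') = p , p' , r , r'

  present : ∀ {τ τ'} → τ ≐ τ' → Pr τ ≃ Pr τ'
  present (p , p' , _) = p , p'

  required : ∀ {τ τ'} → τ ≐ τ' → Rq τ ≃ Rq τ'
  required (_ , _ , r , r') = r , r'

  ≐-refl : ∀ {τ} → τ ≐ τ
  ≐-refl = (λ x → x) , (λ x → x) , (λ x → x) , (λ x → x)

  ≐-sym : ∀ {τ τ'} → τ ≐ τ' → τ' ≐ τ
  ≐-sym (p , p' , r , r') = p' , p , r' , r

  ≐-trans : ∀ {τ τ' τ''} → τ ≐ τ' → τ' ≐ τ'' → τ ≐ τ''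
  ≐-trans (p , p' , r , r') (q , q' , s , s') =
    (λ x → q (p x)) , (λ x → p' (q' x)) , (λ x → s (r x)) , (λ x → r' (s' x))

  membrane-cong : ∀ {P R P' R' A B A' B'} →
                  ⟨ P , R ⟩ ≐ ⟨ A , B ⟩ → ⟨ P' , R' ⟩ ≐ ⟨ A' , B' ⟩ →
                  ⟨ P , R ∖ P' ⟩ ≐ ⟨ A , B ∖ A' ⟩
  membrane-cong e e' = ≐-intro (present e) (∖-cong (required e) (present e'))

  ⊓-cong : ∀ {τ₁ τ₁' τ₂ τ₂'} → τ₁ ≐ τ₁' → τ₂ ≐ τ₂' → (τ₁ ⊓ τ₂) ≐ (τ₁' ⊓ τ₂')
  ⊓-cong e₁ e₂ = ≐-intro (∪-cong (present e₁) (present e₂))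
                         (∖-cong (∪-cong (required e₁) (required e₂)) (∪-cong (present e₁) (present e₂)))

  ⊓-comm : ∀ {τ τ'} → (τ ⊓ τ') ≐ (τ' ⊓ τ)
  ⊓-comm {τ} {τ'} = ≐-intro (∪-comm (Pr τ) (Pr τ')) (∖-cong (∪-comm (Rq τ) (Rq τ')) (∪-comm (Pr τ) (Pr τ')))

  -- Both bracketings require exactly the required types that are not present.
  ⊓-assoc : ∀ {τ₁ τ₂ τ₃} → ((τ₁ ⊓ τ₂) ⊓ τ₃) ≐ (τ₁ ⊓ (τ₂ ⊓ τ₃))
  ⊓-assoc {⟨ P₁ , R₁ ⟩} {⟨ P₂ , R₂ ⟩} {⟨ P₃ , R₃ ⟩} = ≐-intro (∪-assoc P₁ P₂ P₃)
    (Sets.≐-trans (∖-absorbˡ inj₁)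
      (Sets.≐-trans (∖-cong (∪-assoc R₁ R₂ R₃) (∪-assoc P₁ P₂ P₃)) (Sets.≐-sym (∖-absorbʳ inj₂))))

  ⊓-identityʳ : ∀ {τ} → WF τ → (τ ⊓ ⟨ ∅ , ∅ ⟩) ≐ τ
  ⊓-identityʳ (_ , P∩R=∅ , _) =
    ≐-intro ∪-identityʳ (Sets.≐-trans (∖-cong ∪-identityʳ ∪-identityʳ) (∖-disjoint P∩R=∅))

  ⊓-identityˡ : ∀ {τ} → WF τ → (⟨ ∅ , ∅ ⟩ ⊓ τ) ≐ τ
  ⊓-identityˡ wf = ≐-trans ⊓-comm (⊓-identityʳ wf)

  WF-resp : ∀ {τ τ'} → τ ≐ τ' → WF τ → WF τ'
  WF-resp e (w₁ , w₂ , w₃) =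
    disjoint-⊆ p' (Ē-mono p') w₁ , disjoint-⊆ p' r' w₂ , disjoint-⊆ r' (Ē-mono p') w₃
    where
    p' = proj₂ (present e)
    r' = proj₂ (required e)

  ⋈-resp : ∀ {τ₁ τ₁' τ₂ τ₂'} → τ₁ ≐ τ₁' → τ₂ ≐ τ₂' → τ₁ ⋈ τ₂ → τ₁' ⋈ τ₂'
  ⋈-resp e₁ e₂ (w₁ , w₂ , k₁ , k₂ , k₃ , k₄) =
    WF-resp e₁ w₁ , WF-resp e₂ w₂ ,
    disjoint-⊆ (Ē-mono p₁) p₂ k₁ , disjoint-⊆ (Ē-mono p₁) r₂ k₂ ,
    disjoint-⊆ (Ē-mono p₂) p₁ k₃ , disjoint-⊆ (Ē-mono p₂) r₁ k₄
    where
    p₁ = proj₂ (present e₁)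
    p₂ = proj₂ (present e₂)
    r₁ = proj₂ (required e₁)
    r₂ = proj₂ (required e₂)

  ⋈-sym : ∀ {τ τ'} → τ ⋈ τ' → τ' ⋈ τ
  ⋈-sym (w₁ , w₂ , k₁ , k₂ , k₃ , k₄) = w₂ , w₁ , k₃ , k₄ , k₁ , k₂

  WF-ε : WF ⟨ ∅ , ∅ ⟩
  WF-ε = (λ _ → proj₁) , (λ _ → proj₁) , (λ _ → proj₁)

  ⋈-ε : ∀ {τ} → WF τ → τ ⋈ ⟨ ∅ , ∅ ⟩
  ⋈-ε wf = wf , WF-ε , (λ _ → proj₂) , (λ _ → proj₂) ,
           (λ { _ ((_ , () , _) , _) }) , (λ { _ ((_ , () , _) , _) })

  WF-⊓ : ∀ {τ τ'} → τ ⋈ τ' → WF (τ ⊓ τ')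
  WF-⊓ {⟨ P , R ⟩} {⟨ P' , R' ⟩} ((w₁ , _ , w₃) , (v₁ , _ , v₃) , k₁ , k₂ , k₃ , k₄) =
    present-ok , (λ _ (x∈P , _ , x∉P) → x∉P x∈P) , required-ok
    where
    present-ok : Sets.Empty ((P ∪ P') ∩ Ē (P ∪ P'))
    present-ok x (x∈ , excl) with x∈ | Ē-∪ {P} {P'} excl
    ... | inj₁ p | inj₁ e = w₁ x (p , e)
    ... | inj₁ p | inj₂ e = k₃ x (e , p)
    ... | inj₂ p | inj₁ e = k₁ x (e , p)
    ... | inj₂ p | inj₂ e = v₁ x (p , e)
    required-ok : Sets.Empty (((R ∪ R') ∖ (P ∪ P')) ∩ Ē (P ∪ P'))
    required-ok x ((x∈ , _) , excl) with x∈ | Ē-∪ {P} {P'} excl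
    ... | inj₁ r | inj₁ e = w₃ x (r , e)
    ... | inj₁ r | inj₂ e = k₄ x (e , r)
    ... | inj₂ r | inj₁ e = k₂ x (e , r)
    ... | inj₂ r | inj₂ e = v₃ x (r , e)

  ⋈-assoc : ∀ {τ₁ τ₂ τ₃} → τ₁ ⋈ τ₂ → (τ₁ ⊓ τ₂) ⋈ τ₃ → (τ₂ ⋈ τ₃) × (τ₁ ⋈ (τ₂ ⊓ τ₃))
  ⋈-assoc {⟨ P₁ , R₁ ⟩} {⟨ P₂ , R₂ ⟩} {⟨ P₃ , R₃ ⟩}
          (w₁ , w₂ , a₁ , a₂ , a₃ , a₄) (_ , w₃ , b₁ , b₂ , b₃ , b₄) = c₂₃ , c₁
    where
    c₂₃ : ⟨ P₂ , R₂ ⟩ ⋈ ⟨ P₃ , R₃ ⟩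
    c₂₃ = w₂ , w₃ ,
      (λ x (e , p) → b₁ x (Ē-mono inj₂ e , p)) ,
      (λ x (e , r) → b₂ x (Ē-mono inj₂ e , r)) ,
      (λ x (e , p) → b₃ x (e , inj₂ p)) ,
      (λ x (e , r) → b₄ x (e , inj₂ r , λ p → b₃ x (e , p)))
    c₁ : ⟨ P₁ , R₁ ⟩ ⋈ (⟨ P₂ , R₂ ⟩ ⊓ ⟨ P₃ , R₃ ⟩)
    c₁ = w₁ , WF-⊓ c₂₃ , g₁ , g₂ , g₃ , g₄
      where
      g₁ : Sets.Empty (Ē P₁ ∩ (P₂ ∪ P₃))
      g₁ x (e , inj₁ p) = a₁ x (e , p)
      g₁ x (e , inj₂ p) = b₁ x (Ē-mono inj₁ e , p)
      g₂ : Sets.Empty (Ē P₁ ∩ ((R₂ ∪ R₃) ∖ (P₂ ∪ P₃)))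
      g₂ x (e , inj₁ r , _) = a₂ x (e , r)
      g₂ x (e , inj₂ r , _) = b₂ x (Ē-mono inj₁ e , r)
      g₃ : Sets.Empty (Ē (P₂ ∪ P₃) ∩ P₁)
      g₃ x (e , p) with Ē-∪ {P₂} {P₃} e
      ... | inj₁ e' = a₃ x (e' , p)
      ... | inj₂ e' = b₃ x (e' , inj₁ p)
      g₄ : Sets.Empty (Ē (P₂ ∪ P₃) ∩ R₁)
      g₄ x (e , r) with Ē-∪ {P₂} {P₃} e
      ... | inj₁ e' = a₄ x (e' , r)
      ... | inj₂ e' = b₄ x (e' , inj₁ r , λ p → b₃ x (e' , p))

  -- The mirror image of ⋈-assoc, obtained from it by commutativity.
  ⋈-assoc⁻ : ∀ {τ₁ τ₂ τ₃} → τ₂ ⋈ τ₃ → τ₁ ⋈ (τ₂ ⊓ τ₃) → (τ₁ ⋈ τ₂) × ((τ₁ ⊓ τ₂) ⋈ τ₃)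
  ⋈-assoc⁻ c₂₃ c₁ with ⋈-assoc (⋈-sym c₂₃) (⋈-resp ⊓-comm ≐-refl (⋈-sym c₁))
  ... | c₂₁ , c₃ = ⋈-sym c₂₁ , ⋈-sym (⋈-resp ≐-refl ⊓-comm c₃)

  exactS : ∀ {Δ v} {s : Seq v} {τ} → Δ ⊢S s ∶ τ → Δ ⊢S s ∶≈ τ
  exactS d = _ , d , ≐-refl

  exact : ∀ {Δ v} {t : Term v} {τ} → Δ ⊢ t ∶ τ → Δ ⊢ t ∶≈ τ
  exact d = _ , d , ≐-refl

  retypeS : ∀ {Δ v} {s : Seq v} {τ τ'} → τ ≐ τ' → Δ ⊢S s ∶≈ τ → Δ ⊢S s ∶≈ τ'
  retypeS e (_ , d , e₀) = _ , d , ≐-trans e₀ e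

  retype : ∀ {Δ v} {t : Term v} {τ τ'} → τ ≐ τ' → Δ ⊢ t ∶≈ τ → Δ ⊢ t ∶≈ τ'
  retype e (_ , d , e₀) = _ , d , ≐-trans e₀ e

  ≈-· : ∀ {Δ v} {s s' : Seq v} {τ τ'} →
        Δ ⊢S s ∶≈ τ → Δ ⊢S s' ∶≈ τ' → τ ⋈ τ' → Δ ⊢S (s · s') ∶≈ (τ ⊓ τ')
  ≈-· (_ , d , e) (_ , d' , e') c = _ , t-· d d' (⋈-resp (≐-sym e) (≐-sym e') c) , ⊓-cong e e'

  ≈-∣ : ∀ {Δ v} {t t' : Term v} {τ τ'} →
        Δ ⊢ t ∶≈ τ → Δ ⊢ t' ∶≈ τ' → τ ⋈ τ' → Δ ⊢ (t ∣ t') ∶≈ (τ ⊓ τ')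
  ≈-∣ (_ , d , e) (_ , d' , e') c = _ , t-∣ d d' (⋈-resp (≐-sym e) (≐-sym e') c) , ⊓-cong e e'

  ≈-seq : ∀ {Δ v} {s : Seq v} {τ} → Δ ⊢S s ∶≈ τ → Δ ⊢ seq s ∶≈ τ
  ≈-seq (_ , d , e) = _ , t-seq d , e

  ≈-loop : ∀ {Δ v} {s : Seq v} {t : Term v} {P R P' R'} →
           Δ ⊢S s ∶≈ ⟨ P , R ⟩ → Δ ⊢ t ∶≈ ⟨ P' , R' ⟩ → ⟨ P , R ⟩ ⋈ ⟨ P' , R' ⟩ → R' ⊆ P →
           Δ ⊢ loop s t ∶≈ ⟨ P , R ∖ P' ⟩
  ≈-loop (_ , d , e) (_ , d' , e') c R'⊆P =
    _ , t-loop d d' (⋈-resp (≐-sym e) (≐-sym e') c) (λ r → proj₂ (present e) (R'⊆P (proj₁ (required e') r))) ,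
    membrane-cong e e'

  subst-typingS : ∀ {Δ σ} {s : SeqPat} {τ} → AgreesWith σ Δ → Δ ⊢S s ∶ τ → emptyBasis ⊢S instS s σ ∶≈ τ
  subst-typingS (_ , agS , _) (t-svar {n} {τ} eq) = agS n τ eq
  subst-typingS (_ , _ , agE) (t-evar {n} {τ} eq) = agE n τ eq
  subst-typingS ag t-ε = exactS t-ε
  subst-typingS ag (t-el a) = exactS (t-el a)
  subst-typingS ag (t-· d d' c) = ≈-· (subst-typingS ag d) (subst-typingS ag d') c

  subst-typing : ∀ {Δ σ} {t : Pattern} {τ} → AgreesWith σ Δ → Δ ⊢ t ∶ τ → emptyBasis ⊢ instT t σ ∶≈ τ
  subst-typing (agT , _) (t-tvar {n} {τ} eq) = agT n τ eq
  subst-typing ag (t-seq d) = ≈-seq (subst-typingS ag d)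
  subst-typing ag (t-∣ d d' c) = ≈-∣ (subst-typing ag d) (subst-typing ag d') c
  subst-typing ag (t-loop d d' c R'⊆P) = ≈-loop (subst-typingS ag d) (subst-typing ag d') c R'⊆P

  -- Element types are well formed by the assumptions t ∉ R_t ∪ E_t and R_t ∩ E_t = ∅.
  WF-el : ∀ t → WF (elTy t)
  WF-el t = (λ { _ (refl , _ , refl , excl) → t∉Excl t excl }) ,
            (λ { _ (refl , req) → t∉Req t req }) ,
            (λ { x (req , _ , refl , excl) → Req∩Excl t x (req , excl) })

  WF-membrane : ∀ {P R P'} → WF ⟨ P , R ⟩ → WF ⟨ P , R ∖ P' ⟩
  WF-membrane (w₁ , w₂ , w₃) = w₁ , disjoint-⊆ (λ p → p) proj₁ w₂ , disjoint-⊆ proj₁ (λ e → e) w₃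

  WF-typeS : ∀ {s : Sequence} {τ} → emptyBasis ⊢S s ∶ τ → WF τ
  WF-typeS t-ε = WF-ε
  WF-typeS (t-el a) = WF-el (Γ a)
  WF-typeS (t-· _ _ c) = WF-⊓ c

  WF-type : ∀ {t : CTerm} {τ} → emptyBasis ⊢ t ∶ τ → WF τ
  WF-type (t-seq d) = WF-typeS d
  WF-type (t-∣ _ _ c) = WF-⊓ c
  WF-type (t-loop _ _ c _) = WF-membrane (proj₁ c)

  _⇛S_ : Sequence → Sequence → Set₁
  s ⇛S s' = ∀ {τ} → emptyBasis ⊢S s ∶≈ τ → emptyBasis ⊢S s' ∶≈ τ

  _⇛_ : CTerm → CTerm → Set₁
  t ⇛ t' = ∀ {τ} → emptyBasis ⊢ t ∶≈ τ → emptyBasis ⊢ t' ∶≈ τ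

  ·-cong⇛ : ∀ {s₁ s₁' s₂ s₂'} → s₁ ⇛S s₁' → s₂ ⇛S s₂' → (s₁ · s₂) ⇛S (s₁' · s₂')
  ·-cong⇛ f g (_ , t-· d d' c , e) = retypeS e (≈-· (f (exactS d)) (g (exactS d')) c)

  ·-assoc⇛ : ∀ {s₁ s₂ s₃} → ((s₁ · s₂) · s₃) ⇛S (s₁ · (s₂ · s₃))
  ·-assoc⇛ (_ , t-· (t-· d₁ d₂ c₁₂) d₃ c , e) =
    let (c₂₃ , c₁) = ⋈-assoc c₁₂ c in _ , t-· d₁ (t-· d₂ d₃ c₂₃) c₁ , ≐-trans (≐-sym ⊓-assoc) e

  ·-assoc⇚ : ∀ {s₁ s₂ s₃} → (s₁ · (s₂ · s₃)) ⇛S ((s₁ · s₂) · s₃)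
  ·-assoc⇚ (_ , t-· d₁ (t-· d₂ d₃ c₂₃) c , e) =
    let (c₁₂ , c₃) = ⋈-assoc⁻ c₂₃ c in _ , t-· (t-· d₁ d₂ c₁₂) d₃ c₃ , ≐-trans ⊓-assoc e

  ·-unitˡ⇛ : ∀ {s} → (ε · s) ⇛S s
  ·-unitˡ⇛ (_ , t-· t-ε d _ , e) = _ , d , ≐-trans (≐-sym (⊓-identityˡ (WF-typeS d))) e

  ·-unitˡ⇚ : ∀ {s} → s ⇛S (ε · s)
  ·-unitˡ⇚ (_ , d , e) = _ , t-· t-ε d (⋈-sym (⋈-ε (WF-typeS d))) , ≐-trans (⊓-identityˡ (WF-typeS d)) e

  ·-unitʳ⇛ : ∀ {s} → (s · ε) ⇛S s
  ·-unitʳ⇛ (_ , t-· d t-ε _ , e) = _ , d , ≐-trans (≐-sym (⊓-identityʳ (WF-typeS d))) e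

  ·-unitʳ⇚ : ∀ {s} → s ⇛S (s · ε)
  ·-unitʳ⇚ (_ , d , e) = _ , t-· d t-ε (⋈-ε (WF-typeS d)) , ≐-trans (⊓-identityʳ (WF-typeS d)) e

  subject-congruenceS : ∀ {s s'} → s ≈S s' → (s ⇛S s') × (s' ⇛S s)
  subject-congruenceS refl≈ = (λ d → d) , (λ d → d)
  subject-congruenceS (sym≈ p) = let (to , from) = subject-congruenceS p in from , to
  subject-congruenceS (trans≈ p q) =
    let (to₁ , from₁) = subject-congruenceS p ; (to₂ , from₂) = subject-congruenceS q
    in (λ d → to₂ (to₁ d)) , (λ d → from₁ (from₂ d))
  subject-congruenceS (·-cong p q) =
    let (to₁ , from₁) = subject-congruenceS p ; (to₂ , from₂) = subject-congruenceS q
    in ·-cong⇛ to₁ to₂ , ·-cong⇛ from₁ from₂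
  subject-congruenceS ·-assoc = ·-assoc⇛ , ·-assoc⇚
  subject-congruenceS ·-unitˡ = ·-unitˡ⇛ , ·-unitˡ⇚
  subject-congruenceS ·-unitʳ = ·-unitʳ⇛ , ·-unitʳ⇚

  seq-cong⇛ : ∀ {s s'} → s ⇛S s' → seq s ⇛ seq s'
  seq-cong⇛ f (_ , t-seq d , e) = retype e (≈-seq (f (exactS d)))

  loop-cong⇛ : ∀ {s s' t t'} → s ⇛S s' → t ⇛ t' → loop s t ⇛ loop s' t'
  loop-cong⇛ f g (_ , t-loop d d' c R'⊆P , e) = retype e (≈-loop (f (exactS d)) (g (exact d')) c R'⊆P)

  ∣-cong⇛ : ∀ {t₁ t₁' t₂ t₂'} → t₁ ⇛ t₁' → t₂ ⇛ t₂' → (t₁ ∣ t₂) ⇛ (t₁' ∣ t₂')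
  ∣-cong⇛ f g (_ , t-∣ d d' c , e) = retype e (≈-∣ (f (exact d)) (g (exact d')) c)

  ∣-assoc⇛ : ∀ {t₁ t₂ t₃} → ((t₁ ∣ t₂) ∣ t₃) ⇛ (t₁ ∣ (t₂ ∣ t₃))
  ∣-assoc⇛ (_ , t-∣ (t-∣ d₁ d₂ c₁₂) d₃ c , e) =
    let (c₂₃ , c₁) = ⋈-assoc c₁₂ c in _ , t-∣ d₁ (t-∣ d₂ d₃ c₂₃) c₁ , ≐-trans (≐-sym ⊓-assoc) e

  ∣-assoc⇚ : ∀ {t₁ t₂ t₃} → (t₁ ∣ (t₂ ∣ t₃)) ⇛ ((t₁ ∣ t₂) ∣ t₃)
  ∣-assoc⇚ (_ , t-∣ d₁ (t-∣ d₂ d₃ c₂₃) c , e) =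
    let (c₁₂ , c₃) = ⋈-assoc⁻ c₂₃ c in _ , t-∣ (t-∣ d₁ d₂ c₁₂) d₃ c₃ , ≐-trans ⊓-assoc e

  ∣-comm⇛ : ∀ {t₁ t₂} → (t₁ ∣ t₂) ⇛ (t₂ ∣ t₁)
  ∣-comm⇛ (_ , t-∣ d d' c , e) = _ , t-∣ d' d (⋈-sym c) , ≐-trans ⊓-comm e

  ∣-unit⇛ : ∀ {t} → (t ∣ seq ε) ⇛ t
  ∣-unit⇛ (_ , t-∣ d (t-seq t-ε) _ , e) = _ , d , ≐-trans (≐-sym (⊓-identityʳ (WF-type d))) e

  ∣-unit⇚ : ∀ {t} → t ⇛ (t ∣ seq ε)
  ∣-unit⇚ (_ , d , e) = _ , t-∣ d (t-seq t-ε) (⋈-ε (WF-type d)) , ≐-trans (⊓-identityʳ (WF-type d)) e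

  empty-membrane : ⟨ ∅ , ∅ ∖ ∅ ⟩ ≐ ⟨ ∅ , ∅ ⟩
  empty-membrane = ≐-intro Sets.≐-refl (∖-disjoint (λ _ → proj₁))

  loop-empty⇛ : loop ε (seq ε) ⇛ seq ε
  loop-empty⇛ (_ , t-loop t-ε (t-seq t-ε) _ _ , e) = _ , t-seq t-ε , ≐-trans (≐-sym empty-membrane) e

  loop-empty⇚ : seq ε ⇛ loop ε (seq ε)
  loop-empty⇚ (_ , t-seq t-ε , e) = _ , t-loop t-ε (t-seq t-ε) (⋈-ε WF-ε) (λ ()) , ≐-trans empty-membrane e

  -- Rotating a membrane only commutes the conjunction of its elements.
  loop-rot⇛ : ∀ {s₁ s₂ t} → loop (s₁ · s₂) t ⇛ loop (s₂ · s₁) t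
  loop-rot⇛ (_ , t-loop (t-· d₁ d₂ c₁₂) d c R'⊆P , e) =
    retype e (≈-loop (retypeS ⊓-comm (exactS (t-· d₂ d₁ (⋈-sym c₁₂)))) (exact d) c R'⊆P)

  subject-congruence : ∀ {t t'} → t ≈T t' → (t ⇛ t') × (t' ⇛ t)
  subject-congruence refl≈ = (λ d → d) , (λ d → d)
  subject-congruence (sym≈ p) = let (to , from) = subject-congruence p in from , to
  subject-congruence (trans≈ p q) =
    let (to₁ , from₁) = subject-congruence p ; (to₂ , from₂) = subject-congruence q
    in (λ d → to₂ (to₁ d)) , (λ d → from₁ (from₂ d))
  subject-congruence (seq-cong p) =
    let (to , from) = subject-congruenceS p in seq-cong⇛ to , seq-cong⇛ from
  subject-congruence (loop-cong p q) =
    let (to₁ , from₁) = subject-congruenceS p ; (to₂ , from₂) = subject-congruence q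
    in loop-cong⇛ to₁ to₂ , loop-cong⇛ from₁ from₂
  subject-congruence (∣-cong p q) =
    let (to₁ , from₁) = subject-congruence p ; (to₂ , from₂) = subject-congruence q
    in ∣-cong⇛ to₁ to₂ , ∣-cong⇛ from₁ from₂
  subject-congruence ∣-assoc = ∣-assoc⇛ , ∣-assoc⇚
  subject-congruence ∣-comm = ∣-comm⇛ , ∣-comm⇛
  subject-congruence ∣-unit = ∣-unit⇛ , ∣-unit⇚
  subject-congruence loop-empty = loop-empty⇛ , loop-empty⇚
  subject-congruence loop-rot = loop-rot⇛ , loop-rot⇛

  instS-embS : ∀ (s : Sequence) σ → instS (embS s) σ ≡ embS s
  instS-embS ε σ = refl
  instS-embS (el a) σ = refl
  instS-embS (s · s') σ = cong₂ _·_ (instS-embS s σ) (instS-embS s' σ)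

  instT-embT : ∀ (t : CTerm) σ → instT (embT t) σ ≡ embT t
  instT-embT (seq s) σ = cong seq (instS-embS s σ)
  instT-embT (loop s t) σ = cong₂ loop (instS-embS s σ) (instT-embT t σ)
  instT-embT (t ∣ t') σ = cong₂ _∣_ (instT-embT t σ) (instT-embT t' σ)

  -- σ with every term variable sent to u; filling the hole X of C[X].
  _[X≔_] : Inst → CTerm → Inst
  σ [X≔ u ] = record { σT = λ _ → u ; σS = σS σ ; σE = σE σ }

  instT-plug : ∀ C u σ → instT (plug C (tvar 0)) (σ [X≔ u ]) ≡ plug C u
  instT-plug □ u σ = refl
  instT-plug (C ∣ₗ w) u σ = cong₂ _∣_ (instT-plug C u σ) (instT-embT w _)
  instT-plug (w ∣ᵣ C) u σ = cong₂ _∣_ (instT-embT w _) (instT-plug C u σ)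
  instT-plug (loopC s C) u σ = cong₂ loop (instS-embS s _) (instT-plug C u σ)

  fill-agrees : ∀ σ {u τ} → emptyBasis ⊢ u ∶≈ τ → AgreesWith (σ [X≔ u ]) (singleBasis τ)
  fill-agrees σ {u} {τ} d = agT , (λ _ _ ()) , (λ _ _ ())
    where
    agT : ∀ n τ' → ty (singleBasis τ) (tv n) ≡ just τ' → emptyBasis ⊢ u ∶≈ τ'
    agT zero _ refl = d
    agT (suc n) _ ()

  -- If τ is OK for C, then placing any ground term of type τ in the hole
  -- gives a term with no pending requirements.  (The instantiation σ only
  -- supplies values for the absent sequence and element variables.)
  plug-typing : ∀ {τ} C σ {u} → OKfor τ C → emptyBasis ⊢ u ∶≈ τ →
                ∃ λ P' → emptyBasis ⊢ plug C u ∶≈ ⟨ P' , ∅ ⟩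
  plug-typing C σ {u} (_ , P' , _ , dC , e) du =
    P' , subst (λ t → emptyBasis ⊢ t ∶≈ ⟨ P' , ∅ ⟩) (instT-plug C u σ)
               (retype e (subst-typing (fill-agrees σ du) dC))

  subject-reduction : ∀ {ℛ Δ T T'} → Red ℛ Δ T T' → ∃ λ P' → emptyBasis ⊢ T' ∶≈ ⟨ P' , ∅ ⟩
  subject-reduction (step _ τ σ C (_ , d-rhs , e) _ agrees ok) =
    plug-typing C σ ok (retype e (subst-typing agrees d-rhs))
  subject-reduction (closed _ r U'≈T') =
    let (P' , d) = subject-reduction r in P' , proj₁ (subject-congruence U'≈T') d

mainTheorem1 : (𝕊 : Sig) → let open CLS 𝕊 in
    (ℛ : List Rule) (Δ : Basis) (T T' : CTerm) →
    (∃ λ P → emptyBasis ⊢ T ∶≈ ⟨ P , ∅ ⟩) →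
    Red ℛ Δ T T' →
    ∃ λ P' → emptyBasis ⊢ T' ∶≈ ⟨ P' , ∅ ⟩
mainTheorem1 𝕊 ℛ Δ T T' _ T⇒T' = SubjectReduction.subject-reduction 𝕊 T⇒T'
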